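{- Fix an integer $k\ge 2$, a shape $\lambda$ with at most $k-1$ rows, and an integer $m\ge 0$. Then $${\sf W}_k^*(\lambda,m)=\sum_{b=0}^{\lfloor m/2\rfloor}(-1)^b\binom{m-b}{b}\,{\sf O}_k^*(\lambda,m-2b).$$
   Context: A shape (Ferrers diagram) is a finite collection of boxes in left-justified rows of weakly decreasing lengths. A $*$-tableau of shape $\lambda$ and length $m$ is a sequence of shapes $(\lambda^s)_{s=0}^m$ with $\lambda^0=\varnothing$, $\lambda^m=\lambda$, such that for each $1\le s\le m$, $\lambda^s$ is obtained from $\lambda^{s-1}$ by adding one box, removing one box, or doing nothing. ${\sf O}_k^*(\lambda,m)$ is the number of $*$-tableaux of shape $\lambda$ and length $m$ all of whose shapes have at most $k-1$ rows. A pair of steps $(+\square_1,-\square_1)$ in such a tableau is an index $s$ such that $\lambda^{s+1}$ is obtained from $\lambda^s$ by adding a box in the first row and $\lambda^{s+2}$ is obtained from $\lambda^{s+1}$ by removing a box from the first row (so $\lambda^{s+2}=\lambda^s$). ${\sf W}_k^*(\lambda,m)$ is the number of $*$-tableaux of shape $\lambda$ and length $m$ with all shapes having at most $k-1$ rows that contain no pair of steps $(+\square_1,-\square_1)$. -}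

module Defs where

open import Data.Nat using (ℕ; zero; suc; _+_; _∸_; _≤_; _<_; _≤?_; _<?_)
open import Data.Nat.Properties using (_≟_)
open import Data.Nat.Combinatorics using (_C_)
open import Data.Integer as ℤ using (ℤ; +_)
open import Data.List using (List; []; _∷_; _++_; [_]; map; concatMap; filter; length; reverse; foldr; upTo; last)
open import Data.List.Properties using (≡-dec)
open import Data.List.Relation.Unary.All using (All)
open import Data.List.Relation.Unary.All using (all?) renaming (All to All′)
open import Data.Maybe using (Maybe; just; nothing) renaming (map to mapMaybe)
open import Data.Product using (_×_; _,_)
open import Data.Sum using (_⊎_)
open import Data.Empty using (⊥)
open import Data.Unit using (⊤; tt)
open import Relation.Nullary using (Dec; yes; no; ¬_)
open import Relation.Nullary.Decidable using (_×-dec_; _⊎-dec_; ¬?)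
import Data.Maybe.Properties as MP
open import Relation.Binary.PropositionalEquality using (_≡_)

-- A shape (Ferrers diagram) is the list of its row lengths, top row first.
Shape : Set
Shape = List ℕ

Decreasing : List ℕ → Set
Decreasing []           = ⊤
Decreasing (a ∷ [])     = ⊤
Decreasing (a ∷ b ∷ r)  = (b ≤ a) × Decreasing (b ∷ r)

decreasing? : (l : List ℕ) → Dec (Decreasing l)
decreasing? []          = yes tt
decreasing? (a ∷ [])    = yes tt
decreasing? (a ∷ b ∷ r) = (b ≤? a) ×-dec decreasing? (b ∷ r)

IsShape : List ℕ → Set
IsShape l = All (λ a → 0 < a) l × Decreasing l

isShape? : (l : List ℕ) → Dec (IsShape l)
isShape? l = all? (λ a → 0 <? a) l ×-dec decreasing? l

-- Add one box at the end of row i (rows 0-indexed; row = length adds a new row).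
-- The result may fail to be a shape; this is filtered afterwards.
addBox : ℕ → Shape → Maybe Shape
addBox zero    []      = just (1 ∷ [])
addBox zero    (a ∷ r) = just (suc a ∷ r)
addBox (suc i) []      = nothing
addBox (suc i) (a ∷ r) = mapMaybe (a ∷_) (addBox i r)

removeBox : ℕ → Shape → Maybe Shape
removeBox zero    []               = nothing
removeBox zero    (zero ∷ r)       = nothing
removeBox zero    (suc zero ∷ [])  = just []
removeBox zero    (suc a ∷ r)      = just (a ∷ r)
removeBox (suc i) []               = nothing
removeBox (suc i) (a ∷ r)          = mapMaybe (a ∷_) (removeBox i r)

maybeToList : {A : Set} → Maybe A → List A
maybeToList (just x) = x ∷ []
maybeToList nothing  = []

nextShapes : Shape → List Shape
nextShapes μ =
  μ ∷ filter isShape?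
        (concatMap (λ i → maybeToList (addBox i μ) ++ maybeToList (removeBox i μ))
                   (upTo (suc (length μ))))

-- All *-tableaux of length m (of any final shape), stored in reverse order
-- (last shape first), starting from the empty shape.
revTableaux : ℕ → List (List Shape)
revTableaux zero    = ([] ∷ []) ∷ []
revTableaux (suc m) = concatMap ext (revTableaux m)
  where
    ext : List Shape → List (List Shape)
    ext []        = []
    ext (μ ∷ t)   = map (λ ν → ν ∷ μ ∷ t) (nextShapes μ)

tableaux : ℕ → List (List Shape)
tableaux m = map reverse (revTableaux m)

lastShape : List Shape → Shape
lastShape t with last t
... | just μ  = μ
... | nothing = []

RowsBelow : ℕ → List Shape → Set
RowsBelow k t = All (λ μ → suc (length μ) ≤ k) t

row1 : Shape → ℕ
row1 []      = 0
row1 (a ∷ _) = a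

-- a pair of steps (+□₁, −□₁) starting at λ^s:
-- λ^{s+1} is λ^s with a box added in the first row, and λ^{s+2} = λ^s
-- (i.e. λ^{s+2} is λ^{s+1} with a box removed from the first row).
HasPair : List Shape → Set
HasPair []              = ⊥
HasPair (μ ∷ [])        = ⊥
HasPair (μ ∷ ν ∷ [])    = ⊥
HasPair (μ ∷ ν ∷ ρ ∷ t) =
  ((addBox 0 μ ≡ just ν) × (removeBox 0 ν ≡ just ρ)) ⊎ HasPair (ν ∷ ρ ∷ t)

hasPair? : (t : List Shape) → Dec (HasPair t)
hasPair? []              = no (λ ())
hasPair? (μ ∷ [])        = no (λ ())
hasPair? (μ ∷ ν ∷ [])    = no (λ ())
hasPair? (μ ∷ ν ∷ ρ ∷ t) =
  (MP.≡-dec (≡-dec _≟_) (addBox 0 μ) (just ν) ×-dec MP.≡-dec (≡-dec _≟_) (removeBox 0 ν) (just ρ))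
  ⊎-dec hasPair? (ν ∷ ρ ∷ t)

rowsBelow? : (k : ℕ) (t : List Shape) → Dec (RowsBelow k t)
rowsBelow? k t = all? (λ μ → suc (length μ) ≤? k) t

EndsAt : Shape → List Shape → Set
EndsAt λ′ t = lastShape t ≡ λ′

endsAt? : (λ′ : Shape) (t : List Shape) → Dec (EndsAt λ′ t)
endsAt? λ′ t = ≡-dec _≟_ (lastShape t) λ′

O* : ℕ → Shape → ℕ → ℕ
O* k λ′ m = length (filter (λ t → rowsBelow? k t ×-dec endsAt? λ′ t) (tableaux m))

W* : ℕ → Shape → ℕ → ℕ
W* k λ′ m =
  length (filter (λ t → rowsBelow? k t ×-dec endsAt? λ′ t ×-dec ¬? (hasPair? t)) (tableaux m))

sign : ℕ → ℤ
sign zero    = + 1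
sign (suc b) = ℤ.- sign b

sumℤ : List ℤ → ℤ
sumℤ = foldr ℤ._+_ (+ 0)

-- Weight each *-tableau by a function f of its final shape, and let O m f and W m f be
-- the weighted counts of all, resp. pair-free, tableaux of length m with at most k-1 rows;
-- O*_k(λ,m) and W*_k(λ,m) are the case f = [· = λ]. With step f μ the sum of f over the
-- allowed shapes one step away from μ, O (m+1) f = O m (step f). Extending a pair-free
-- tableau by one step keeps it pair-free unless the step closes a pair (+□₁,−□₁); such a
-- step returns to the shape two steps back and the shape in between is forced, so the
-- extensions lost in length m+2 are counted by W m f. Hence
--   W (m+2) f = W (m+1) (step f) − W m f,   W 0 = O 0,   W 1 = O 1,
-- a Chebyshev recursion whose solution is W m f = Σ_b (−1)^b C(m−b,b) O (m−2b) f.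

module Submission where

open import Level using (Level)
open import Function using (_∘_; id; _⇔_; mk⇔; Equivalence)
open import Data.Bool using (Bool; true; false; _∧_; _∨_; not)
open import Data.Bool.Properties using (∧-identityʳ; ∧-zeroʳ)
open import Data.Empty using (⊥)
open import Data.Product using (_×_; _,_)
open import Data.Sum as Sum using (_⊎_; inj₁; inj₂)
open import Data.Maybe using (Maybe; just; nothing)
import Data.Maybe.Properties as Maybe
open import Data.Nat as ℕ using (ℕ; zero; suc; _≤_; _<_; _∸_; _*_; s≤s; z≤n)
import Data.Nat.Properties as ℕ
open import Data.Nat.Properties using (_≟_)
open import Data.Nat.DivMod using (_/_; _%_; m≡m%n+[m/n]*n; m%n<n)
open import Data.Nat.Combinatorics using (_C_; k>n⇒nCk≡0; nCk+nC[k+1]≡[n+1]C[k+1])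
open import Data.Nat.ListAction using (sum)
open import Data.Integer as ℤ using (ℤ; +_; _+_; _-_; -_)
import Data.Integer.Properties as ℤ
open import Data.Integer.Tactic.RingSolver using (solve-∀)
open import Data.List using (List; []; _∷_; _++_; _∷ʳ_; map; concatMap; filter; length; upTo; reverse; last)
open import Data.List.Properties using (≡-dec; map-upTo; upTo-∷ʳ; concatMap-cong; unfold-reverse; ʳ++-defn)
open import Data.List.Relation.Unary.All as All using (All; []; _∷_)
import Data.List.Relation.Unary.All.Properties as All
open import Data.List.Relation.Binary.Permutation.Propositional using (↭-sym)
open import Data.List.Relation.Binary.Permutation.Propositional.Properties using (All-resp-↭; ↭-reverse)
open import Relation.Binary.PropositionalEquality
open import Relation.Nullary using (Dec; does; yes; no; ¬_)
open import Relation.Nullary.Decidable using (_×-dec_; _⊎-dec_; dec-true; dec-false; does-⇔)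
open import Relation.Unary using (Pred; Decidable)

open import Defs

when : Bool → ℤ → ℤ
when true  x = x
when false x = + 0

when-zero : ∀ b → when b (+ 0) ≡ + 0
when-zero true  = refl
when-zero false = refl

when-∧ : ∀ a b x → when (a ∧ b) x ≡ when a (when b x)
when-∧ true  b x = refl
when-∧ false b x = refl

when-minus : ∀ b x y → when b (x - y) ≡ when b x - when b y
when-minus true  x y = refl
when-minus false x y = refl

when-comm : ∀ a b x → when a (when b x) ≡ when b (when a x)
when-comm true  b x = refl
when-comm false b x = sym (when-zero b)

∑ : {A : Set} → List A → (A → ℤ) → ℤ
∑ xs w = sumℤ (map w xs)

syntax ∑ xs (λ x → w) = ∑[ x ← xs ] w

module _ {A : Set} where

  ∑-++ : (xs ys : List A) (w : A → ℤ) → ∑ (xs ++ ys) w ≡ ∑ xs w + ∑ ys w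
  ∑-++ []       ys w = sym (ℤ.+-identityˡ _)
  ∑-++ (x ∷ xs) ys w = trans (cong (_+_ (w x)) (∑-++ xs ys w)) (sym (ℤ.+-assoc (w x) _ _))

  ∑-congᴬ : {ℓ : Level} {P : Pred A ℓ} (xs : List A) {w w′ : A → ℤ} →
            All P xs → (∀ x → P x → w x ≡ w′ x) → ∑ xs w ≡ ∑ xs w′
  ∑-congᴬ []       []       e = refl
  ∑-congᴬ (x ∷ xs) (p ∷ ps) e = cong₂ _+_ (e x p) (∑-congᴬ xs ps e)

  ∑-cong : (xs : List A) {w w′ : A → ℤ} → (∀ x → w x ≡ w′ x) → ∑ xs w ≡ ∑ xs w′
  ∑-cong []       e = refl
  ∑-cong (x ∷ xs) e = cong₂ _+_ (e x) (∑-cong xs e)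

  ∑-zero : (xs : List A) {w : A → ℤ} → (∀ x → w x ≡ + 0) → ∑ xs w ≡ + 0
  ∑-zero []       e = refl
  ∑-zero (x ∷ xs) e = cong₂ _+_ (e x) (∑-zero xs e)

  ∑-minus : (xs : List A) (w w′ : A → ℤ) → ∑[ x ← xs ] (w x - w′ x) ≡ ∑ xs w - ∑ xs w′
  ∑-minus []       w w′ = refl
  ∑-minus (x ∷ xs) w w′ = trans (cong (_+_ (w x - w′ x)) (∑-minus xs w w′)) (interchange (w x) (w′ x) _ _)
    where
    interchange : ∀ a b c d → (a - b) + (c - d) ≡ (a + c) - (b + d)
    interchange = solve-∀

  ∑-when : (xs : List A) (b : Bool) (w : A → ℤ) → ∑[ x ← xs ] when b (w x) ≡ when b (∑ xs w)
  ∑-when xs true  w = refl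
  ∑-when xs false w = ∑-zero xs (λ _ → refl)

  ∑-filter : {ℓ : Level} {P : Pred A ℓ} (P? : Decidable P) (xs : List A) (w : A → ℤ) →
             ∑ (filter P? xs) w ≡ ∑[ x ← xs ] when (does (P? x)) (w x)
  ∑-filter P? []       w = refl
  ∑-filter P? (x ∷ xs) w with does (P? x)
  ... | true  = cong (_+_ (w x)) (∑-filter P? xs w)
  ... | false = trans (∑-filter P? xs w) (sym (ℤ.+-identityˡ _))

  length-filter-∑ : {ℓ : Level} {P : Pred A ℓ} (P? : Decidable P) (xs : List A) →
                    + length (filter P? xs) ≡ ∑[ x ← xs ] when (does (P? x)) (+ 1)
  length-filter-∑ P? []       = refl
  length-filter-∑ P? (x ∷ xs) with does (P? x)
  ... | true  = trans (ℤ.pos-+ 1 _) (cong (_+_ (+ 1)) (length-filter-∑ P? xs))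
  ... | false = trans (length-filter-∑ P? xs) (sym (ℤ.+-identityˡ _))

module _ {A B : Set} where

  ∑-map : (h : A → B) (xs : List A) (w : B → ℤ) → ∑ (map h xs) w ≡ ∑[ x ← xs ] w (h x)
  ∑-map h []       w = refl
  ∑-map h (x ∷ xs) w = cong (_+_ (w (h x))) (∑-map h xs w)

  ∑-concatMap : (e : A → List B) (xs : List A) (w : B → ℤ) →
                ∑ (concatMap e xs) w ≡ ∑[ x ← xs ] ∑ (e x) w
  ∑-concatMap e []       w = refl
  ∑-concatMap e (x ∷ xs) w =
    trans (∑-++ (e x) (concatMap e xs) w) (cong (_+_ (∑ (e x) w)) (∑-concatMap e xs w))

∑-upTo-suc : ∀ n (h : ℕ → ℤ) → ∑ (upTo (suc n)) h ≡ h 0 + ∑[ b ← upTo n ] h (suc b)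
∑-upTo-suc n h = cong (_+_ (h 0)) (trans (cong (λ xs → ∑ xs h) (sym (map-upTo suc n))) (∑-map suc (upTo n) h))

∑-upTo-∷ʳ : ∀ n (h : ℕ → ℤ) → ∑ (upTo (suc n)) h ≡ ∑ (upTo n) h + h n
∑-upTo-∷ʳ n h = begin
  ∑ (upTo (suc n)) h         ≡⟨ cong (λ xs → ∑ xs h) (sym (upTo-∷ʳ n)) ⟩
  ∑ (upTo n ∷ʳ n) h          ≡⟨ ∑-++ (upTo n) (n ∷ []) h ⟩
  ∑ (upTo n) h + (h n + + 0) ≡⟨ cong (_+_ (∑ (upTo n) h)) (ℤ.+-identityʳ (h n)) ⟩
  ∑ (upTo n) h + h n         ∎
  where open ≡-Reasoning

-- A Chebyshev recursion

nC0≡1 : ∀ n → n C 0 ≡ 1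
nC0≡1 zero    = refl
nC0≡1 (suc n) = refl

pascal-∸ : ∀ m b → (suc m ∸ b) C suc b ≡ (m ∸ b) C b ℕ.+ (m ∸ b) C suc b
pascal-∸ m b with b ℕ.≤? m
... | yes b≤m rewrite ℕ.+-∸-assoc 1 b≤m = sym (nCk+nC[k+1]≡[n+1]C[k+1] (m ∸ b) b)
... | no b≰m with b | ℕ.≰⇒> b≰m
...   | suc b′ | s≤s m≤b′ rewrite ℕ.m≤n⇒m∸n≡0 m≤b′ | ℕ.m≤n⇒m∸n≡0 (ℕ.m≤n⇒m≤1+n m≤b′) = refl

[m∸b]Cc≡0 : ∀ {m b o c} → m ≤ b ℕ.+ o → o < c → (m ∸ b) C c ≡ 0
[m∸b]Cc≡0 {m} {b} m≤b+o o<c = k>n⇒nCk≡0 (ℕ.≤-<-trans (ℕ.m≤n+o⇒m∸n≤o m b m≤b+o) o<c)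

2*≡+ : ∀ b → 2 * b ≡ b ℕ.+ b
2*≡+ b = cong (b ℕ.+_) (ℕ.+-identityʳ b)

∸-2*-suc : ∀ m b → suc m ∸ 2 * suc b ≡ m ∸ suc (2 * b)
∸-2*-suc m b rewrite ℕ.+-suc b (b ℕ.+ 0) = refl

module Chebyshev {F : Set} (O W : ℕ → F → ℤ) (step : F → F)
  (O-suc     : ∀ m f → O (suc m) f ≡ O m (step f))
  (W-zero    : ∀ f → W 0 f ≡ O 0 f)
  (W-one     : ∀ f → W 1 f ≡ O 1 f)
  (W-suc-suc : ∀ m f → W (suc (suc m)) f ≡ W (suc m) (step f) - W m f) where

  term : ℕ → ℕ → F → ℤ
  term m b f = sign b ℤ.* + ((m ∸ b) C b) ℤ.* O (m ∸ 2 * b) f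

  term-zero : ∀ m f → term m 0 f ≡ O m f
  term-zero m f rewrite nC0≡1 m = ℤ.*-identityˡ (O m f)

  term-vanishes : ∀ m b f → m < 2 * b → term m b f ≡ + 0
  term-vanishes m (suc b) f m<2b = begin
    sign (suc b) ℤ.* + ((m ∸ suc b) C suc b) ℤ.* O (m ∸ 2 * suc b) f
      ≡⟨ cong (λ c → sign (suc b) ℤ.* + c ℤ.* O (m ∸ 2 * suc b) f) ([m∸b]Cc≡0 {m} {suc b} m≤1+b+b ℕ.≤-refl) ⟩
    sign (suc b) ℤ.* + 0 ℤ.* O (m ∸ 2 * suc b) f
      ≡⟨ cong (ℤ._* O (m ∸ 2 * suc b) f) (ℤ.*-zeroʳ (sign (suc b))) ⟩
    + 0 ∎
    where
    open ≡-Reasoning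
    m≤1+b+b : m ≤ suc b ℕ.+ b
    m≤1+b+b = ℕ.≤-pred (subst (m <_) (trans (2*≡+ (suc b)) (cong suc (ℕ.+-suc b b))) m<2b)

  shifted-term : ∀ m b f →
    + ((m ∸ b) C suc b) ℤ.* O (m ∸ suc (2 * b)) (step f) ≡ + ((m ∸ b) C suc b) ℤ.* O (m ∸ 2 * b) f
  shifted-term m b f with suc (2 * b) ℕ.≤? m
  ... | yes 2b<m = cong (+ ((m ∸ b) C suc b) ℤ.*_)
                     (trans (sym (O-suc _ f)) (cong (λ j → O j f) (sym (ℕ.+-∸-assoc 1 2b<m))))
  ... | no 2b≮m rewrite [m∸b]Cc≡0 {m} {b} {b} {suc b}
                          (subst (m ≤_) (2*≡+ b) (ℕ.≤-pred (ℕ.≰⇒> 2b≮m))) ℕ.≤-refl = refl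

  term-suc-suc : ∀ m b f → term (suc (suc m)) (suc b) f ≡ term (suc m) (suc b) (step f) - term m b f
  term-suc-suc m b f = begin
    term (suc (suc m)) (suc b) f
      ≡⟨ cong₂ (λ c j → - sign b ℤ.* + c ℤ.* O j f) (pascal-∸ m b) (∸-2*-suc (suc m) b) ⟩
    - s ℤ.* + (c₁ ℕ.+ c₂) ℤ.* O (m ∸ 2 * b) f
      ≡⟨ cong (λ c → - s ℤ.* c ℤ.* O (m ∸ 2 * b) f) (ℤ.pos-+ c₁ c₂) ⟩
    - s ℤ.* (+ c₁ + + c₂) ℤ.* O (m ∸ 2 * b) f
      ≡⟨ distribute s (+ c₁) (+ c₂) (O (m ∸ 2 * b) f) ⟩
    - s ℤ.* (+ c₂ ℤ.* O (m ∸ 2 * b) f) - term m b f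
      ≡⟨ cong (λ x → - s ℤ.* x - term m b f) (sym (shifted-term m b f)) ⟩
    - s ℤ.* (+ c₂ ℤ.* O (m ∸ suc (2 * b)) (step f)) - term m b f
      ≡⟨ cong (_- term m b f) (sym (ℤ.*-assoc (- s) (+ c₂) _)) ⟩
    - s ℤ.* + c₂ ℤ.* O (m ∸ suc (2 * b)) (step f) - term m b f
      ≡⟨ cong (λ j → - s ℤ.* + c₂ ℤ.* O j (step f) - term m b f) (sym (∸-2*-suc m b)) ⟩
    term (suc m) (suc b) (step f) - term m b f ∎
    where
    open ≡-Reasoning
    s : ℤ
    s = sign b
    c₁ c₂ : ℕ
    c₁ = (m ∸ b) C b
    c₂ = (m ∸ b) C suc b
    distribute : ∀ s c₁ c₂ x → - s ℤ.* (c₁ + c₂) ℤ.* x ≡ - s ℤ.* (c₂ ℤ.* x) - s ℤ.* c₁ ℤ.* x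
    distribute = solve-∀

  ∑-term-below-two : ∀ m N f → m < 2 → ∑[ b ← upTo (suc N) ] term m b f ≡ O m f
  ∑-term-below-two m N f m<2 = begin
    ∑[ b ← upTo (suc N) ] term m b f            ≡⟨ ∑-upTo-suc N (λ b → term m b f) ⟩
    term m 0 f + ∑[ b ← upTo N ] term m (suc b) f
      ≡⟨ cong₂ _+_ (term-zero m f) (∑-zero (upTo N) (λ b → term-vanishes m (suc b) f (ℕ.<-≤-trans m<2 (2≤2*suc b)))) ⟩
    O m f + + 0                                   ≡⟨ ℤ.+-identityʳ (O m f) ⟩
    O m f ∎
    where
    open ≡-Reasoning
    2≤2*suc : ∀ b → 2 ≤ 2 * suc b
    2≤2*suc b = ℕ.*-monoʳ-≤ 2 (s≤s z≤n)

  W≡∑term : ∀ m f N → m < 2 * N → W m f ≡ ∑[ b ← upTo N ] term m b f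
  W≡∑term m             f zero    ()
  W≡∑term zero          f (suc N) _ = trans (W-zero f) (sym (∑-term-below-two 0 N f (s≤s z≤n)))
  W≡∑term (suc zero)    f (suc N) _ = trans (W-one f) (sym (∑-term-below-two 1 N f ℕ.≤-refl))
  W≡∑term (suc (suc m)) f (suc N) m+2<2N+2 = begin
    W (suc (suc m)) f
      ≡⟨ W-suc-suc m f ⟩
    W (suc m) (step f) - W m f
      ≡⟨ cong₂ _-_ (W≡∑term (suc m) (step f) (suc N) (ℕ.<-trans (ℕ.n<1+n _) m+2<2N+2))
                   (W≡∑term m f (suc N) (ℕ.<-trans (ℕ.n<1+n _) (ℕ.<-trans (ℕ.n<1+n _) m+2<2N+2))) ⟩
    ∑[ b ← upTo (suc N) ] term (suc m) b (step f) - ∑[ b ← upTo (suc N) ] term m b f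
      ≡⟨ cong₂ _-_ (∑-upTo-suc N (λ b → term (suc m) b (step f))) lower ⟩
    (term (suc m) 0 (step f) + ∑[ b ← upTo N ] term (suc m) (suc b) (step f)) - ∑[ b ← upTo N ] term m b f
      ≡⟨ regroup (term (suc m) 0 (step f)) (∑[ b ← upTo N ] term (suc m) (suc b) (step f)) (∑[ b ← upTo N ] term m b f) ⟩
    term (suc m) 0 (step f) + (∑[ b ← upTo N ] term (suc m) (suc b) (step f) - ∑[ b ← upTo N ] term m b f)
      ≡⟨ cong₂ _+_ shift-zero (sym (∑-minus (upTo N) (λ b → term (suc m) (suc b) (step f)) (λ b → term m b f))) ⟩
    term (suc (suc m)) 0 f + ∑[ b ← upTo N ] (term (suc m) (suc b) (step f) - term m b f)
      ≡⟨ cong (_+_ (term (suc (suc m)) 0 f)) (∑-cong (upTo N) (λ b → sym (term-suc-suc m b f))) ⟩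
    term (suc (suc m)) 0 f + ∑[ b ← upTo N ] term (suc (suc m)) (suc b) f
      ≡⟨ sym (∑-upTo-suc N (λ b → term (suc (suc m)) b f)) ⟩
    ∑[ b ← upTo (suc N) ] term (suc (suc m)) b f ∎
    where
    open ≡-Reasoning
    regroup : ∀ a x y → (a + x) - y ≡ a + (x - y)
    regroup = solve-∀
    m<2N : m < 2 * N
    m<2N rewrite ℕ.*-suc 2 N = ℕ.≤-pred (ℕ.≤-pred m+2<2N+2)
    lower : ∑[ b ← upTo (suc N) ] term m b f ≡ ∑[ b ← upTo N ] term m b f
    lower = begin
      ∑[ b ← upTo (suc N) ] term m b f      ≡⟨ ∑-upTo-∷ʳ N (λ b → term m b f) ⟩
      ∑[ b ← upTo N ] term m b f + term m N f ≡⟨ cong (_+_ (∑[ b ← upTo N ] term m b f)) (term-vanishes m N f m<2N) ⟩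
      ∑[ b ← upTo N ] term m b f + + 0       ≡⟨ ℤ.+-identityʳ (∑[ b ← upTo N ] term m b f) ⟩
      ∑[ b ← upTo N ] term m b f ∎
    shift-zero : term (suc m) 0 (step f) ≡ term (suc (suc m)) 0 f
    shift-zero = trans (term-zero (suc m) (step f)) (trans (sym (O-suc (suc m) f)) (sym (term-zero (suc (suc m)) f)))

-- Pairs of steps (+□₁,−□₁)

PairStep : Shape → Shape → Shape → Set
PairStep μ ν ρ = (addBox 0 μ ≡ just ν) × (removeBox 0 ν ≡ just ρ)

PairAtEnd : List Shape → Shape → Set
PairAtEnd (μ ∷ ν ∷ [])    ρ = PairStep μ ν ρ
PairAtEnd (_ ∷ ν ∷ ξ ∷ t) ρ = PairAtEnd (ν ∷ ξ ∷ t) ρ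
PairAtEnd _               ρ = ⊥

HasPair-∷ʳ : ∀ t ρ → HasPair (t ∷ʳ ρ) ⇔ (HasPair t ⊎ PairAtEnd t ρ)
HasPair-∷ʳ []              ρ = mk⇔ (λ ()) (Sum.[ (λ ()) , (λ ()) ])
HasPair-∷ʳ (μ ∷ [])        ρ = mk⇔ (λ ()) (Sum.[ (λ ()) , (λ ()) ])
HasPair-∷ʳ (μ ∷ ν ∷ [])    ρ = mk⇔ Sum.[ inj₂ , (λ ()) ] Sum.[ (λ ()) , inj₁ ]
HasPair-∷ʳ (μ ∷ ν ∷ ξ ∷ t) ρ = mk⇔ (Sum.assocˡ ∘ Sum.map₂ to) (Sum.map₂ from ∘ Sum.assocʳ)
  where open Equivalence (HasPair-∷ʳ (ν ∷ ξ ∷ t) ρ)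

PairAtEnd-++ : ∀ t μ ν ρ → PairAtEnd (t ++ μ ∷ ν ∷ []) ρ ≡ PairStep μ ν ρ
PairAtEnd-++ []               μ ν ρ = refl
PairAtEnd-++ (_ ∷ [])         μ ν ρ = refl
PairAtEnd-++ (_ ∷ _ ∷ [])     μ ν ρ = refl
PairAtEnd-++ (_ ∷ ξ ∷ ξ′ ∷ t) μ ν ρ = PairAtEnd-++ (ξ ∷ ξ′ ∷ t) μ ν ρ

_≟ₛ_ : (μ ν : Shape) → Dec (μ ≡ ν)
_≟ₛ_ = ≡-dec _≟_

_≟ₘ_ : (μ ν : Maybe Shape) → Dec (μ ≡ ν)
_≟ₘ_ = Maybe.≡-dec _≟ₛ_

pairStep? : ∀ μ ν ρ → Dec (PairStep μ ν ρ)
pairStep? μ ν ρ = (addBox 0 μ ≟ₘ just ν) ×-dec (removeBox 0 ν ≟ₘ just ρ)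

-- revTableaux lists the shapes of a tableau newest first; current is its final shape.
current : List Shape → Shape
current []      = []
current (μ ∷ _) = μ

ClosesPair : Shape → List Shape → Set
ClosesPair ρ (ν ∷ μ ∷ _) = PairStep μ ν ρ
ClosesPair ρ _           = ⊥

closesPair? : ∀ ρ rt → Dec (ClosesPair ρ rt)
closesPair? ρ []          = no (λ ())
closesPair? ρ (ν ∷ [])    = no (λ ())
closesPair? ρ (ν ∷ μ ∷ _) = pairStep? μ ν ρ

HasPairʳ : List Shape → Set
HasPairʳ []       = ⊥
HasPairʳ (ρ ∷ rt) = ClosesPair ρ rt ⊎ HasPairʳ rt

hasPairʳ? : ∀ rt → Dec (HasPairʳ rt)
hasPairʳ? []       = no (λ ())
hasPairʳ? (ρ ∷ rt) = closesPair? ρ rt ⊎-dec hasPairʳ? rt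

PairAtEnd-reverse : ∀ ρ rt → PairAtEnd (reverse rt) ρ ≡ ClosesPair ρ rt
PairAtEnd-reverse ρ []          = refl
PairAtEnd-reverse ρ (ν ∷ [])    = refl
PairAtEnd-reverse ρ (ν ∷ μ ∷ t) =
  trans (cong (λ xs → PairAtEnd xs ρ) (ʳ++-defn t)) (PairAtEnd-++ (reverse t) μ ν ρ)

HasPair-reverse : ∀ rt → HasPair (reverse rt) ⇔ HasPairʳ rt
HasPair-reverse []       = mk⇔ (λ ()) (λ ())
HasPair-reverse (ρ ∷ rt) =
  subst (λ t → HasPair t ⇔ HasPairʳ (ρ ∷ rt)) (sym (unfold-reverse ρ rt))
    (mk⇔ (Sum.swap ∘ Sum.map (to ih) (subst id atEnd) ∘ to split)
         (from split ∘ Sum.map (from ih) (subst id (sym atEnd)) ∘ Sum.swap))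
  where
  open Equivalence
  ih : HasPair (reverse rt) ⇔ HasPairʳ rt
  ih = HasPair-reverse rt
  split : HasPair (reverse rt ∷ʳ ρ) ⇔ (HasPair (reverse rt) ⊎ PairAtEnd (reverse rt) ρ)
  split = HasPair-∷ʳ (reverse rt) ρ
  atEnd : PairAtEnd (reverse rt) ρ ≡ ClosesPair ρ rt
  atEnd = PairAtEnd-reverse ρ rt

last-∷ʳ : {A : Set} (xs : List A) (x : A) → last (xs ∷ʳ x) ≡ just x
last-∷ʳ []           x = refl
last-∷ʳ (_ ∷ [])     x = refl
last-∷ʳ (_ ∷ y ∷ xs) x = last-∷ʳ (y ∷ xs) x

lastShape-reverse : ∀ rt → lastShape (reverse rt) ≡ current rt
lastShape-reverse []       = refl
lastShape-reverse (μ ∷ rt) rewrite unfold-reverse μ rt | last-∷ʳ (reverse rt) μ = refl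

addFirst : Shape → Shape
addFirst []      = 1 ∷ []
addFirst (a ∷ r) = suc a ∷ r

addBox-zero : ∀ μ → addBox 0 μ ≡ just (addFirst μ)
addBox-zero []      = refl
addBox-zero (a ∷ r) = refl

removeBox-addFirst : ∀ μ → IsShape μ → removeBox 0 (addFirst μ) ≡ just μ
removeBox-addFirst []          _            = refl
removeBox-addFirst (suc a ∷ r) _            = refl
removeBox-addFirst (zero ∷ r)  (() ∷ _ , _)

isShape-addFirst : ∀ μ → IsShape μ → IsShape (addFirst μ)
isShape-addFirst []          _                   = (s≤s z≤n ∷ []) , _
isShape-addFirst (a ∷ [])    (_ ∷ ps , _)        = (s≤s z≤n ∷ ps) , _
isShape-addFirst (a ∷ b ∷ r) (_ ∷ ps , b≤a , d) = (s≤s z≤n ∷ ps) , ℕ.m≤n⇒m≤1+n b≤a , d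

sum-addBox : ∀ i μ {ν} → addBox i μ ≡ just ν → sum ν ≡ suc (sum μ)
sum-addBox zero    []      refl = refl
sum-addBox zero    (a ∷ r) refl = refl
sum-addBox (suc i) (a ∷ r) eq with addBox i r in eq′
sum-addBox (suc i) (a ∷ r) refl | just ν = trans (cong (a ℕ.+_) (sum-addBox i r eq′)) (ℕ.+-suc a (sum r))

sum-removeBox : ∀ i μ {ν} → removeBox i μ ≡ just ν → sum μ ≡ suc (sum ν)
sum-removeBox zero    (suc zero ∷ [])     refl = refl
sum-removeBox zero    (suc zero ∷ b ∷ r)  refl = refl
sum-removeBox zero    (suc (suc a) ∷ r)   refl = refl
sum-removeBox (suc i) (a ∷ r) eq with removeBox i r in eq′
sum-removeBox (suc i) (a ∷ r) refl | just ν = trans (cong (a ℕ.+_) (sum-removeBox i r eq′)) (ℕ.+-suc a (sum ν))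

sum-addFirst : ∀ μ → sum (addFirst μ) ≡ suc (sum μ)
sum-addFirst μ = sum-addBox 0 μ (addBox-zero μ)

row1-addBox-suc : ∀ i μ {ν} → addBox (suc i) μ ≡ just ν → row1 ν ≡ row1 μ
row1-addBox-suc i (a ∷ r) eq with addBox i r
row1-addBox-suc i (a ∷ r) refl | just _ = refl

row1-removeBox-suc : ∀ i μ {ν} → removeBox (suc i) μ ≡ just ν → row1 ν ≡ row1 μ
row1-removeBox-suc i (a ∷ r) eq with removeBox i r
row1-removeBox-suc i (a ∷ r) refl | just _ = refl

row1-addFirst : ∀ μ → row1 (addFirst μ) ≡ suc (row1 μ)
row1-addFirst []      = refl
row1-addFirst (a ∷ r) = refl

pointMass : Shape → ℤ → Shape → ℤ
pointMass y c ν = when (does (ν ≟ₛ y)) c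

pointMass-≢ : ∀ {y ν} c → ν ≢ y → pointMass y c ν ≡ + 0
pointMass-≢ {y} {ν} c ν≢y rewrite dec-false (ν ≟ₛ y) ν≢y = refl

pointMass-self : ∀ y c → pointMass y c y ≡ c
pointMass-self y c rewrite dec-true (y ≟ₛ y) refl = refl

pointMass-isShape : ∀ {y} c → IsShape y → ∀ ν → when (does (isShape? ν)) (pointMass y c ν) ≡ pointMass y c ν
pointMass-isShape {y} c y-shape ν with ν ≟ₛ y
... | yes refl rewrite dec-true (isShape? y) y-shape = refl
... | no _     = when-zero (does (isShape? ν))

∑-maybeToList-pointMass : ∀ {y} c mν → mν ≢ just y → ∑ (maybeToList mν) (pointMass y c) ≡ + 0
∑-maybeToList-pointMass c nothing  _  = refl
∑-maybeToList-pointMass c (just ν) ne = cong (_+ + 0) (pointMass-≢ c (ne ∘ cong just))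

moves : Shape → ℕ → List Shape
moves μ i = maybeToList (addBox i μ) ++ maybeToList (removeBox i μ)

∑-moves-pointMass : ∀ {y} c μ i → addBox i μ ≢ just y → removeBox i μ ≢ just y →
                    ∑ (moves μ i) (pointMass y c) ≡ + 0
∑-moves-pointMass c μ i add≢ remove≢ =
  trans (∑-++ (maybeToList (addBox i μ)) _ (pointMass _ c))
        (cong₂ _+_ (∑-maybeToList-pointMass c _ add≢) (∑-maybeToList-pointMass c _ remove≢))

∑-nextShapes-pointMass : ∀ μ {y} c → IsShape y → μ ≢ y →
  (∀ i → ∑ (moves μ (suc i)) (pointMass y c) ≡ + 0) →
  ∑ (nextShapes μ) (pointMass y c) ≡ ∑ (moves μ 0) (pointMass y c)
∑-nextShapes-pointMass μ {y} c y-shape μ≢y higher = begin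
  pointMass y c μ + ∑ (filter isShape? candidates) (pointMass y c)
    ≡⟨ cong₂ _+_ (pointMass-≢ c μ≢y) (∑-filter isShape? candidates (pointMass y c)) ⟩
  + 0 + ∑[ ν ← candidates ] when (does (isShape? ν)) (pointMass y c ν)
    ≡⟨ trans (ℤ.+-identityˡ _) (∑-cong candidates (pointMass-isShape c y-shape)) ⟩
  ∑ candidates (pointMass y c)
    ≡⟨ ∑-concatMap (moves μ) (upTo (suc (length μ))) (pointMass y c) ⟩
  ∑[ i ← upTo (suc (length μ)) ] ∑ (moves μ i) (pointMass y c)
    ≡⟨ ∑-upTo-suc (length μ) (λ i → ∑ (moves μ i) (pointMass y c)) ⟩
  ∑ (moves μ 0) (pointMass y c) + ∑[ i ← upTo (length μ) ] ∑ (moves μ (suc i)) (pointMass y c)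
    ≡⟨ cong (_+_ (∑ (moves μ 0) (pointMass y c))) (∑-zero (upTo (length μ)) higher) ⟩
  ∑ (moves μ 0) (pointMass y c) + + 0
    ≡⟨ ℤ.+-identityʳ _ ⟩
  ∑ (moves μ 0) (pointMass y c) ∎
  where
  open ≡-Reasoning
  candidates : List Shape
  candidates = concatMap (moves μ) (upTo (suc (length μ)))

-- The box count separates additions from removals, the first row separates row 0 from the others.
∑-nextShapes-pointMass-addFirst : ∀ μ c → IsShape μ → ∑ (nextShapes μ) (pointMass (addFirst μ) c) ≡ c
∑-nextShapes-pointMass-addFirst μ c μ-shape =
  trans (∑-nextShapes-pointMass μ c (isShape-addFirst μ μ-shape) μ≢addFirst
          (λ i → ∑-moves-pointMass c μ (suc i) (addBox-suc≢ i) (removeBox≢ (suc i))))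
  (begin
    ∑ (moves μ 0) (pointMass (addFirst μ) c)
      ≡⟨ cong (λ mν → ∑ (maybeToList mν ++ maybeToList (removeBox 0 μ)) (pointMass (addFirst μ) c)) (addBox-zero μ) ⟩
    pointMass (addFirst μ) c (addFirst μ) + ∑ (maybeToList (removeBox 0 μ)) (pointMass (addFirst μ) c)
      ≡⟨ cong₂ _+_ (pointMass-self (addFirst μ) c) (∑-maybeToList-pointMass c _ (removeBox≢ 0)) ⟩
    c + + 0
      ≡⟨ ℤ.+-identityʳ c ⟩
    c ∎)
  where
  open ≡-Reasoning
  μ≢addFirst : μ ≢ addFirst μ
  μ≢addFirst eq = ℕ.1+n≢n (sym (trans (cong sum eq) (sum-addFirst μ)))
  addBox-suc≢ : ∀ i → addBox (suc i) μ ≢ just (addFirst μ)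
  addBox-suc≢ i eq = ℕ.1+n≢n (trans (sym (row1-addFirst μ)) (row1-addBox-suc i μ eq))
  removeBox≢ : ∀ i → removeBox i μ ≢ just (addFirst μ)
  removeBox≢ i eq = ℕ.m≢1+n+m (sum μ) (trans (sum-removeBox i μ eq) (cong suc (sum-addFirst μ)))

∑-nextShapes-addFirst-pointMass : ∀ μ c → IsShape μ → ∑ (nextShapes (addFirst μ)) (pointMass μ c) ≡ c
∑-nextShapes-addFirst-pointMass μ c μ-shape =
  trans (∑-nextShapes-pointMass (addFirst μ) c μ-shape addFirst≢μ
          (λ i → ∑-moves-pointMass c (addFirst μ) (suc i) (addBox≢ (suc i)) (removeBox-suc≢ i)))
  (begin
    ∑ (moves (addFirst μ) 0) (pointMass μ c)
      ≡⟨ cong (λ mν → ∑ (maybeToList (addBox 0 (addFirst μ)) ++ maybeToList mν) (pointMass μ c)) (removeBox-addFirst μ μ-shape) ⟩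
    ∑ (maybeToList (addBox 0 (addFirst μ)) ++ μ ∷ []) (pointMass μ c)
      ≡⟨ ∑-++ (maybeToList (addBox 0 (addFirst μ))) (μ ∷ []) (pointMass μ c) ⟩
    ∑ (maybeToList (addBox 0 (addFirst μ))) (pointMass μ c) + (pointMass μ c μ + + 0)
      ≡⟨ cong₂ _+_ (∑-maybeToList-pointMass c _ (addBox≢ 0)) (trans (ℤ.+-identityʳ _) (pointMass-self μ c)) ⟩
    + 0 + c
      ≡⟨ ℤ.+-identityˡ c ⟩
    c ∎)
  where
  open ≡-Reasoning
  addFirst≢μ : addFirst μ ≢ μ
  addFirst≢μ eq = ℕ.1+n≢n (trans (sym (sum-addFirst μ)) (cong sum eq))
  addBox≢ : ∀ i → addBox i (addFirst μ) ≢ just μ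
  addBox≢ i eq = ℕ.m≢1+n+m (sum μ) (trans (sum-addBox i (addFirst μ) eq) (cong suc (sum-addFirst μ)))
  removeBox-suc≢ : ∀ i → removeBox (suc i) (addFirst μ) ≢ just μ
  removeBox-suc≢ i eq = ℕ.1+n≢n (sym (trans (row1-removeBox-suc i (addFirst μ) eq) (row1-addFirst μ)))

StartsWithShape : List Shape → Set
StartsWithShape []      = ⊥
StartsWithShape (μ ∷ _) = IsShape μ

extend : List Shape → List (List Shape)
extend []       = []
extend (μ ∷ rt) = map (λ ν → ν ∷ μ ∷ rt) (nextShapes μ)

revTableaux-suc : ∀ m → revTableaux (suc m) ≡ concatMap extend (revTableaux m)
revTableaux-suc m = concatMap-cong (λ { [] → refl ; (μ ∷ rt) → refl }) (revTableaux m)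

nextShapes-isShape : ∀ μ → IsShape μ → All IsShape (nextShapes μ)
nextShapes-isShape μ μ-shape = μ-shape ∷ All.all-filter isShape? (concatMap (moves μ) (upTo (suc (length μ))))

revTableaux-startsWithShape : ∀ m → All StartsWithShape (revTableaux m)
revTableaux-startsWithShape zero    = ([] , _) ∷ []
revTableaux-startsWithShape (suc m) rewrite revTableaux-suc m =
  All.concat⁺ (All.map⁺ (All.map extend-starts (revTableaux-startsWithShape m)))
  where
  extend-starts : ∀ {rt} → StartsWithShape rt → All StartsWithShape (extend rt)
  extend-starts {μ ∷ rt} μ-shape = All.map⁺ (nextShapes-isShape μ μ-shape)

∑-revTableaux-suc : ∀ m (w v : List Shape → ℤ) →
  (∀ μ rt → IsShape μ → ∑[ ν ← nextShapes μ ] w (ν ∷ μ ∷ rt) ≡ v (μ ∷ rt)) →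
  ∑ (revTableaux (suc m)) w ≡ ∑ (revTableaux m) v
∑-revTableaux-suc m w v step = begin
  ∑ (revTableaux (suc m)) w               ≡⟨ cong (λ rts → ∑ rts w) (revTableaux-suc m) ⟩
  ∑ (concatMap extend (revTableaux m)) w  ≡⟨ ∑-concatMap extend (revTableaux m) w ⟩
  ∑[ rt ← revTableaux m ] ∑ (extend rt) w ≡⟨ ∑-congᴬ (revTableaux m) (revTableaux-startsWithShape m) extend-step ⟩
  ∑ (revTableaux m) v ∎
  where
  open ≡-Reasoning
  extend-step : ∀ rt → StartsWithShape rt → ∑ (extend rt) w ≡ v rt
  extend-step (μ ∷ rt) μ-shape = trans (∑-map (λ ν → ν ∷ μ ∷ rt) (nextShapes μ) w) (step μ rt μ-shape)

¬ClosesPair-addFirst : ∀ μ rt → ¬ ClosesPair (addFirst μ) (μ ∷ rt)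
¬ClosesPair-addFirst μ (μ′ ∷ rt) (_ , remove≡) =
  ℕ.m≢1+n+m (sum μ) (trans (sum-removeBox 0 μ remove≡) (cong suc (sum-addFirst μ)))

-- The transfer identities

module Transfer (k : ℕ) (2≤k : 2 ≤ k) where

  allowed : Shape → Bool
  allowed ν = does (suc (length ν) ℕ.≤? k)

  admissible : List Shape → Bool
  admissible rt = does (rowsBelow? k rt)

  pairFree : List Shape → Bool
  pairFree rt = not (does (hasPairʳ? rt))

  good : List Shape → Bool
  good rt = admissible rt ∧ pairFree rt

  O W : ℕ → (Shape → ℤ) → ℤ
  O m f = ∑[ rt ← revTableaux m ] when (admissible rt) (f (current rt))
  W m f = ∑[ rt ← revTableaux m ] when (good rt) (f (current rt))

  step : (Shape → ℤ) → Shape → ℤ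
  step f μ = ∑[ ν ← nextShapes μ ] when (allowed ν) (f ν)

  -- The extensions of pair-free tableaux lost by W at the next step: those closing a pair.
  closing : (Shape → ℤ) → List Shape → ℤ
  closing f rt = ∑[ ν ← nextShapes (current rt) ] when (allowed ν ∧ does (closesPair? ν rt)) (f ν)

  pairClosing : ℕ → (Shape → ℤ) → ℤ
  pairClosing m f = ∑[ rt ← revTableaux m ] when (good rt) (closing f rt)

  allowed-addFirst : ∀ μ → allowed (addFirst μ) ≡ allowed μ
  allowed-addFirst []      = trans (dec-true (2 ℕ.≤? k) 2≤k) (sym (dec-true (1 ℕ.≤? k) (ℕ.<-trans ℕ.≤-refl 2≤k)))
  allowed-addFirst (a ∷ r) = refl

  O-suc : ∀ m f → O (suc m) f ≡ O m (step f)
  O-suc m f = ∑-revTableaux-suc m _ _ λ μ rt _ →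
    trans (∑-cong (nextShapes μ) (λ ν → trans (when-∧ (allowed ν) _ (f ν)) (when-comm (allowed ν) _ (f ν))))
          (∑-when (nextShapes μ) (admissible (μ ∷ rt)) _)

  W-suc : ∀ m f → W (suc m) f ≡ W m (step f) - pairClosing m f
  W-suc m f = trans (∑-revTableaux-suc m _ (λ rt → when (good rt) (step f (current rt)) - when (good rt) (closing f rt)) extend-step)
                    (∑-minus (revTableaux m) _ _)
    where
    open ≡-Reasoning
    when-extend : ∀ a b p r x → when ((a ∧ b) ∧ not (p ∨ r)) x ≡ when (b ∧ not r) (when a x - when (a ∧ p) x)
    when-extend false b p     r x = sym (when-zero (b ∧ not r))
    when-extend true  b true  r x = trans (cong (λ c → when c x) (∧-zeroʳ b))
                                          (sym (trans (cong (when (b ∧ not r)) (ℤ.+-inverseʳ x)) (when-zero _)))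
    when-extend true  b false r x = cong (when (b ∧ not r)) (sym (ℤ.+-identityʳ x))
    extend-step : ∀ μ rt → IsShape μ →
      ∑[ ν ← nextShapes μ ] when (good (ν ∷ μ ∷ rt)) (f ν)
        ≡ when (good (μ ∷ rt)) (step f μ) - when (good (μ ∷ rt)) (closing f (μ ∷ rt))
    extend-step μ rt _ = begin
      ∑[ ν ← nextShapes μ ] when (good (ν ∷ μ ∷ rt)) (f ν)
        ≡⟨ ∑-cong (nextShapes μ) (λ ν → when-extend (allowed ν) (admissible (μ ∷ rt))
                                     (does (closesPair? ν (μ ∷ rt))) (does (hasPairʳ? (μ ∷ rt))) (f ν)) ⟩
      ∑[ ν ← nextShapes μ ] when (good (μ ∷ rt)) (g ν - h ν)
        ≡⟨ ∑-when (nextShapes μ) (good (μ ∷ rt)) (λ ν → g ν - h ν) ⟩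
      when (good (μ ∷ rt)) (∑[ ν ← nextShapes μ ] (g ν - h ν))
        ≡⟨ cong (when (good (μ ∷ rt))) (∑-minus (nextShapes μ) g h) ⟩
      when (good (μ ∷ rt)) (step f μ - closing f (μ ∷ rt))
        ≡⟨ when-minus (good (μ ∷ rt)) (step f μ) (closing f (μ ∷ rt)) ⟩
      when (good (μ ∷ rt)) (step f μ) - when (good (μ ∷ rt)) (closing f (μ ∷ rt)) ∎
      where
      g h : Shape → ℤ
      g ν = when (allowed ν) (f ν)
      h ν = when (allowed ν ∧ does (closesPair? ν (μ ∷ rt))) (f ν)

  closing-addFirst : ∀ μ rt f → IsShape μ → closing f (addFirst μ ∷ μ ∷ rt) ≡ when (allowed μ) (f μ)
  closing-addFirst μ rt f μ-shape =
    trans (∑-cong (nextShapes (addFirst μ)) closing-term) (∑-nextShapes-addFirst-pointMass μ _ μ-shape)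
    where
    closing-term : ∀ ρ → when (allowed ρ ∧ does (pairStep? μ (addFirst μ) ρ)) (f ρ)
                           ≡ pointMass μ (when (allowed μ) (f μ)) ρ
    closing-term ρ
      rewrite dec-true (addBox 0 μ ≟ₘ just (addFirst μ)) (addBox-zero μ) | removeBox-addFirst μ μ-shape
      with ρ ≟ₛ μ
    ... | yes refl rewrite dec-true (just ρ ≟ₘ just ρ) refl = cong (λ b → when b (f ρ)) (∧-identityʳ (allowed ρ))
    ... | no ρ≢μ rewrite dec-false (just μ ≟ₘ just ρ) (ρ≢μ ∘ sym ∘ Maybe.just-injective) =
      cong (λ b → when b (f ρ)) (∧-zeroʳ (allowed ρ))

  closing-not-addFirst : ∀ μ rt f ν → ν ≢ addFirst μ → closing f (ν ∷ μ ∷ rt) ≡ + 0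
  closing-not-addFirst μ rt f ν ν≢addFirst
    rewrite dec-false (addBox 0 μ ≟ₘ just ν) (λ eq → ν≢addFirst (Maybe.just-injective (trans (sym eq) (addBox-zero μ)))) =
    ∑-zero (nextShapes ν) (λ ρ → cong (λ b → when b (f ρ)) (∧-zeroʳ (allowed ρ)))

  good-addFirst : ∀ μ rt → good (addFirst μ ∷ μ ∷ rt) ≡ good (μ ∷ rt)
  good-addFirst μ rt = begin
    (allowed (addFirst μ) ∧ admissible (μ ∷ rt)) ∧ not (does (closesPair? (addFirst μ) (μ ∷ rt)) ∨ does (hasPairʳ? (μ ∷ rt)))
      ≡⟨ cong₂ (λ a c → (a ∧ admissible (μ ∷ rt)) ∧ not (c ∨ does (hasPairʳ? (μ ∷ rt))))
               (allowed-addFirst μ) (dec-false (closesPair? (addFirst μ) (μ ∷ rt)) (¬ClosesPair-addFirst μ rt)) ⟩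
    (allowed μ ∧ admissible (μ ∷ rt)) ∧ not (false ∨ does (hasPairʳ? (μ ∷ rt)))
      ≡⟨ drop-repeat (allowed μ) (admissible rt) (does (hasPairʳ? (μ ∷ rt))) ⟩
    good (μ ∷ rt) ∎
    where
    open ≡-Reasoning
    drop-repeat : ∀ a o r → (a ∧ (a ∧ o)) ∧ not (false ∨ r) ≡ (a ∧ o) ∧ not r
    drop-repeat true  o r = refl
    drop-repeat false o r = refl

  pairClosing-suc : ∀ m f → pairClosing (suc m) f ≡ W m f
  pairClosing-suc m f = ∑-revTableaux-suc m _ _ λ μ rt μ-shape →
    trans (∑-cong (nextShapes μ) (summand μ rt μ-shape))
          (∑-nextShapes-pointMass-addFirst μ _ μ-shape)
    where
    absorb : ∀ a o p x → when ((a ∧ o) ∧ p) (when a x) ≡ when ((a ∧ o) ∧ p) x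
    absorb true  o p x = refl
    absorb false o p x = refl
    summand : ∀ μ rt → IsShape μ → ∀ ν →
      when (good (ν ∷ μ ∷ rt)) (closing f (ν ∷ μ ∷ rt)) ≡ pointMass (addFirst μ) (when (good (μ ∷ rt)) (f μ)) ν
    summand μ rt μ-shape ν with ν ≟ₛ addFirst μ
    ... | yes refl = trans (cong₂ when (good-addFirst μ rt) (closing-addFirst μ rt f μ-shape))
                           (absorb (allowed μ) (admissible rt) (pairFree (μ ∷ rt)) (f μ))
    ... | no ν≢addFirst = trans (cong (when (good (ν ∷ μ ∷ rt))) (closing-not-addFirst μ rt f ν ν≢addFirst))
                                (when-zero (good (ν ∷ μ ∷ rt)))

  pairClosing-zero : ∀ f → pairClosing 0 f ≡ + 0
  pairClosing-zero f = begin
    when (good ([] ∷ [])) (closing f ([] ∷ [])) + + 0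
      ≡⟨ cong (λ x → when (good ([] ∷ [])) x + + 0)
              (∑-zero (nextShapes []) (λ ν → cong (λ b → when b (f ν)) (∧-zeroʳ (allowed ν)))) ⟩
    when (good ([] ∷ [])) (+ 0) + + 0
      ≡⟨ cong (_+ + 0) (when-zero (good ([] ∷ []))) ⟩
    + 0 ∎
    where open ≡-Reasoning

  W-zero : ∀ f → W 0 f ≡ O 0 f
  W-zero f = cong (λ b → when b (f []) + + 0) (∧-identityʳ (admissible ([] ∷ [])))

  W-one : ∀ f → W 1 f ≡ O 1 f
  W-one f = begin
    W 1 f                             ≡⟨ W-suc 0 f ⟩
    W 0 (step f) - pairClosing 0 f    ≡⟨ cong (_-_ (W 0 (step f))) (pairClosing-zero f) ⟩
    W 0 (step f) - + 0                ≡⟨ ℤ.+-identityʳ (W 0 (step f)) ⟩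
    W 0 (step f)                      ≡⟨ W-zero (step f) ⟩
    O 0 (step f)                      ≡⟨ sym (O-suc 0 f) ⟩
    O 1 f ∎
    where open ≡-Reasoning

  W-suc-suc : ∀ m f → W (suc (suc m)) f ≡ W (suc m) (step f) - W m f
  W-suc-suc m f = trans (W-suc (suc m) f) (cong (_-_ (W (suc m) (step f))) (pairClosing-suc m f))

  open Chebyshev O W step O-suc W-zero W-one W-suc-suc public

  admissible-reverse : ∀ rt → does (rowsBelow? k (reverse rt)) ≡ admissible rt
  admissible-reverse rt = does-⇔ (mk⇔ (All-resp-↭ (↭-reverse rt)) (All-resp-↭ (↭-sym (↭-reverse rt))))
                                 (rowsBelow? k (reverse rt)) (rowsBelow? k rt)

  pairFree-reverse : ∀ rt → not (does (hasPair? (reverse rt))) ≡ pairFree rt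
  pairFree-reverse rt = cong not (does-⇔ (HasPair-reverse rt) (hasPair? (reverse rt)) (hasPairʳ? rt))

  endsAt-reverse : ∀ λ′ rt → does (endsAt? λ′ (reverse rt)) ≡ does (current rt ≟ₛ λ′)
  endsAt-reverse λ′ rt = cong (λ μ → does (μ ≟ₛ λ′)) (lastShape-reverse rt)

  O*≡O : ∀ λ′ m → + O* k λ′ m ≡ O m (pointMass λ′ (+ 1))
  O*≡O λ′ m =
    trans (length-filter-∑ _ (map reverse (revTableaux m)))
    (trans (∑-map reverse (revTableaux m) _)
           (∑-cong (revTableaux m) λ rt →
              trans (cong₂ (λ a e → when (a ∧ e) (+ 1)) (admissible-reverse rt) (endsAt-reverse λ′ rt))
                    (when-∧ (admissible rt) _ (+ 1))))

  W*≡W : ∀ λ′ m → + W* k λ′ m ≡ W m (pointMass λ′ (+ 1))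
  W*≡W λ′ m =
    trans (length-filter-∑ _ (map reverse (revTableaux m)))
    (trans (∑-map reverse (revTableaux m) _)
           (∑-cong (revTableaux m) λ rt →
              trans (cong₂ (λ a b → when (a ∧ b) (+ 1)) (admissible-reverse rt)
                           (cong₂ _∧_ (endsAt-reverse λ′ rt) (pairFree-reverse rt)))
                    (regroup (admissible rt) _ (pairFree rt) (+ 1))))
    where
    regroup : ∀ a e p x → when (a ∧ e ∧ p) x ≡ when (a ∧ p) (when e x)
    regroup true  e true  x = cong (λ b → when b x) (∧-identityʳ e)
    regroup true  e false x = cong (λ b → when b x) (∧-zeroʳ e)
    regroup false e p     x = refl

m<2*[1+m/2] : ∀ m → m < 2 * suc (m / 2)
m<2*[1+m/2] m = begin-strict
  m                   ≡⟨ m≡m%n+[m/n]*n m 2 ⟩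
  m % 2 ℕ.+ m / 2 * 2 <⟨ ℕ.+-monoˡ-< (m / 2 * 2) (m%n<n m 2) ⟩
  2 ℕ.+ m / 2 * 2     ≡⟨ cong (2 ℕ.+_) (ℕ.*-comm (m / 2) 2) ⟩
  2 ℕ.+ 2 * (m / 2)   ≡⟨ sym (ℕ.*-suc 2 (m / 2)) ⟩
  2 * suc (m / 2)     ∎
  where open ℕ.≤-Reasoning

lemma4 : (k : ℕ) → 2 ≤ k → (λ′ : Shape) → IsShape λ′ → suc (length λ′) ≤ k → (m : ℕ) →
    + W* k λ′ m
      ≡ sumℤ (map (λ b → sign b ℤ.* (+ ((m ∸ b) C b)) ℤ.* (+ O* k λ′ (m ∸ 2 * b)))
                  (upTo (suc (m / 2))))
lemma4 k 2≤k λ′ _ _ m = begin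
  + W* k λ′ m                                   ≡⟨ W*≡W λ′ m ⟩
  W m δ                                         ≡⟨ W≡∑term m δ (suc (m / 2)) (m<2*[1+m/2] m) ⟩
  ∑[ b ← upTo (suc (m / 2)) ] term m b δ        ≡⟨ ∑-cong (upTo (suc (m / 2))) (λ b →
                                                     cong (sign b ℤ.* + ((m ∸ b) C b) ℤ.*_) (sym (O*≡O λ′ (m ∸ 2 * b)))) ⟩
  sumℤ (map (λ b → sign b ℤ.* (+ ((m ∸ b) C b)) ℤ.* (+ O* k λ′ (m ∸ 2 * b))) (upTo (suc (m / 2)))) ∎
  where
  open ≡-Reasoning
  open Transfer k 2≤k
  δ : Shape → ℤ
  δ = pointMass λ′ (+ 1)
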